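{- Let $L$ be a finite modular lattice that is diamond-colored by a set $I$. Suppose $\mathbf{s}\le\mathbf{t}$ in $L$ and let $$\mathbf{s}=\mathbf{r}_0\xrightarrow{i_1}\mathbf{r}_1\xrightarrow{i_2}\cdots\xrightarrow{i_p}\mathbf{r}_p=\mathbf{t}\quad\text{and}\quad \mathbf{s}=\mathbf{r}'_0\xrightarrow{j_1}\mathbf{r}'_1\xrightarrow{j_2}\cdots\xrightarrow{j_q}\mathbf{r}'_q=\mathbf{t}$$ be two paths from $\mathbf{s}$ up to $\mathbf{t}$ (each step a covering relation, labeled by its edge color). Then $p=q$ and, for every $i\in I$, $|\{k: i_k=i\}|=|\{k: j_k=i\}|$. Moreover, if $\mathbf{r}_1$ and $\mathbf{r}'_{p-1}$ are incomparable, then $i_1=j_p$.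
   Context: All posets are finite. In a poset, $\mathbf{x}\to\mathbf{y}$ means $\mathbf{y}$ covers $\mathbf{x}$. An edge-colored poset is a poset together with a function assigning to each covering relation $\mathbf{x}\to\mathbf{y}$ a color in a set $I$, written $\mathbf{x}\xrightarrow{i}\mathbf{y}$. It is diamond-colored (has the diamond coloring property) if whenever $\mathbf{w}\xrightarrow{k}\mathbf{x}\xrightarrow{i}\mathbf{z}$ and $\mathbf{w}\xrightarrow{l}\mathbf{y}\xrightarrow{j}\mathbf{z}$ with $\mathbf{x}\neq\mathbf{y}$, then $i=l$ and $j=k$ (parallel edges of a diamond have the same color). A finite lattice $L$ is modular if it is ranked, i.e. has a function $\rho:L\to\{0,\dots,l\}$ onto with $\rho(\mathbf{y})=\rho(\mathbf{x})+1$ whenever $\mathbf{x}\to\mathbf{y}$, satisfying $\rho(\mathbf{s}\vee\mathbf{t})+\rho(\mathbf{s}\wedge\mathbf{t})=\rho(\mathbf{s})+\rho(\mathbf{t})$ for all $\mathbf{s},\mathbf{t}$ (equivalently, any two distinct elements covering a common element are both covered by a unique common element, and dually). -}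

module Defs where

open import Data.Nat as ℕ using (ℕ; zero; suc; _+_)
open import Data.Fin using (Fin; zero; suc; inject₁; fromℕ)
open import Data.Product using (Σ; _×_; ∃; ∃-syntax)
open import Data.Sum using (_⊎_)
open import Data.List using (List)
open import Data.List.Membership.Propositional using (_∈_)
open import Data.Unit using (⊤)
open import Relation.Nullary using (¬_)
open import Relation.Binary.PropositionalEquality using (_≡_; _≢_)

Finite : Set → Set
Finite C = Σ (List C) λ xs → ∀ x → x ∈ xs

module _ {C : Set} (_≤_ : C → C → Set) where

  _<_ : C → C → Set
  x < y = (x ≤ y) × (x ≢ y)

  -- covering relation: x ⋖ y  means  y covers x  (x → y)
  _⋖_ : C → C → Set
  x ⋖ y = (x < y) × (∀ z → x ≤ z → z ≤ y → (z ≡ x) ⊎ (z ≡ y))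

  Incomparable : C → C → Set
  Incomparable x y = (¬ (x ≤ y)) × (¬ (y ≤ x))

  EdgeColoring : Set → Set
  EdgeColoring I = (x y : C) → x ⋖ y → I

  -- the color depends only on the covering pair, not on the proof of covering
  ColoringWellDefined : {I : Set} → EdgeColoring I → Set
  ColoringWellDefined col = ∀ x y (a b : x ⋖ y) → col x y a ≡ col x y b

  DiamondColored : {I : Set} → EdgeColoring I → Set
  DiamondColored col =
    ∀ w x y z (wx : w ⋖ x) (xz : x ⋖ z) (wy : w ⋖ y) (yz : y ⋖ z) →
      x ≢ y → (col x z xz ≡ col w y wy) × (col y z yz ≡ col w x wx)

  IsModularRanked : (_∨_ _∧_ : C → C → C) → Set
  IsModularRanked _∨_ _∧_ =
    Σ (C → ℕ) λ ρ → Σ ℕ λ l →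
      (∀ x → ρ x ℕ.≤ l) ×
      (∀ k → k ℕ.≤ l → ∃[ x ] ρ x ≡ k) ×
      (∀ x y → x ⋖ y → ρ y ≡ suc (ρ x)) ×
      (∀ s t → ρ (s ∨ t) + ρ (s ∧ t) ≡ ρ s + ρ t)

  record Path (s t : C) (p : ℕ) : Set where
    field
      vert  : Fin (suc p) → C
      start : vert zero ≡ s
      end   : vert (fromℕ p) ≡ t
      step  : (k : Fin p) → vert (inject₁ k) ⋖ vert (suc k)
  open Path public

  -- color of the (k+1)-th step of a path  (i_{k+1})
  stepColor : {I : Set} → EdgeColoring I → {s t : C} {p : ℕ} → Path s t p → Fin p → I
  stepColor col P k = col _ _ (step P k)

  FirstLastClause : {I : Set} → EdgeColoring I → {s t : C} {p q : ℕ} →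
                    Path s t p → Path s t q → Set
  FirstLastClause col {p = suc p} {q = suc q} P Q =
    Incomparable (vert P (suc zero)) (vert Q (inject₁ (fromℕ q))) →
    stepColor col P zero ≡ stepColor col Q (fromℕ q)
  FirstLastClause col {p = zero}  {q = _}     P Q = ⊤
  FirstLastClause col {p = suc _} {q = zero}  P Q = ⊤

module Submission where

-- Let L be a finite lattice with a rank function ρ satisfying the
-- modular law, coloured with the diamond property.
--  * Finiteness makes equality, and hence ≤, decidable.  Counting the elements
--    of intervals then shows that ρ is strictly monotone, so that x ≤ y with
--    ρ y = ρ x + 1 is a covering.
--  * Diamond completion: if b ≠ b' both cover a, then b ∧ b' = a, so by the
--    modular law ρ (b ∨ b') = ρ a + 2 and b ∨ b' covers both b and b'; by the
--    diamond property the two new edges carry the colours of the opposite edges.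
--  * Exchange: a covering a ⋖ b below the top t of a chain from a can be moved
--    to the front of that chain, permuting its colours (induction on the chain,
--    completing one diamond per step).  Hence any two covering chains with the
--    same endpoints have colour lists that are permutations of each other; this
--    gives p = q and equal colour multiplicities.
--  * The same induction shows: if b ≰ u for the last covering u ⋖ t of a chain,
--    the colour of a ⋖ b equals that of u ⋖ t, the "moreover" clause.

open import Defs
open import Data.Nat using (ℕ)
open import Data.Fin using (Fin)
open import Data.Product using (Σ; _×_)
open import Function.Bundles using (_↔_)
open import Relation.Binary.PropositionalEquality using (_≡_)
open import Relation.Binary.Lattice.Structures using (IsLattice)

open import Data.Nat as ℕ using (zero; suc)
import Data.Nat.Properties as ℕₚ
open import Data.Fin as Fin using (zero; suc; inject₁; fromℕ)
open import Data.Product using (_,_; proj₁; proj₂)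
open import Data.Sum using (_⊎_; inj₁; inj₂)
open import Data.Empty using (⊥-elim)
open import Data.Unit using (tt)
open import Data.List using (List; []; _∷_; tabulate; lookup; length; filter)
open import Data.List.Properties using (length-tabulate)
open import Data.List.Relation.Unary.Any as Any using (Any; here; there)
open import Data.List.Relation.Unary.Any.Properties using (lookup-index; tabulate⁺; tabulate⁻)
open import Data.List.Membership.Propositional using (_∈_)
open import Data.List.Relation.Binary.Sublist.Propositional using (⊆-refl)
open import Data.List.Relation.Binary.Sublist.Propositional.Properties using (filter⁺; length-mono-≤)
open import Data.List.Relation.Binary.Permutation.Propositional
  using (_↭_; ↭-refl; ↭-reflexive; ↭-trans; ↭-prep; ↭-swap; module PermutationReasoning)
open import Data.List.Relation.Binary.Permutation.Propositional.Properties using (↭-length)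
open import Data.List.Relation.Binary.BagAndSetEquality using (↭⇒∼bag)
open import Function.Base using (_∘_)
open import Function.Bundles using (mk↔ₛ′)
open import Function.Properties.Inverse using (↔-trans; ↔-sym)
open import Relation.Nullary using (¬_; yes; no; contradiction)
open import Relation.Nullary.Decidable using (_×-dec_; ¬?; map′)
open import Relation.Unary using () renaming (Decidable to Decidable₁)
open import Relation.Binary.Definitions using (Decidable; DecidableEquality)
open import Relation.Binary.Structures using (IsPartialOrder)
import Relation.Binary.Lattice.Properties.JoinSemilattice as JoinSemilatticeProperties
open import Relation.Binary.PropositionalEquality
  using (_≢_; refl; sym; trans; cong; cong₂; subst; module ≡-Reasoning)

occurrences↔∈ : {A : Set} {n : ℕ} (f : Fin n → A) (i : A) →
                Σ (Fin n) (λ k → f k ≡ i) ↔ (i ∈ tabulate f)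
occurrences↔∈ {A} f i = mk↔ₛ′ to from to∘from from∘to
  where
  to : ∀ {n} {f : Fin n → A} {i} → Σ (Fin n) (λ k → f k ≡ i) → i ∈ tabulate f
  to (k , fk≡i) = tabulate⁺ k (sym fk≡i)

  from : ∀ {n} {f : Fin n → A} {i} → i ∈ tabulate f → Σ (Fin n) (λ k → f k ≡ i)
  from i∈ = let k , i≡fk = tabulate⁻ i∈ in k , sym i≡fk

  to∘from : ∀ {n} {f : Fin n → A} {i} (i∈ : i ∈ tabulate f) → to {f = f} (from i∈) ≡ i∈
  to∘from {suc _} (here refl) = refl
  to∘from {suc _} (there i∈) = cong there (to∘from i∈)

  from∘to : ∀ {n} {f : Fin n → A} {i} (occ : Σ (Fin n) (λ k → f k ≡ i)) → from {f = f} (to occ) ≡ occ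
  from∘to (zero , refl) = refl
  from∘to (suc k , fk≡i) = cong (λ (k′ , e) → suc k′ , e) (from∘to (k , fk≡i))

filter-length-< : {A : Set} {P Q : A → Set} (P? : Decidable₁ P) (Q? : Decidable₁ Q) →
                  (∀ {z} → Q z → P z) → ∀ {xs} → Any (λ z → P z × ¬ Q z) xs →
                  length (filter Q? xs) ℕ.< length (filter P? xs)
filter-length-< P? Q? Q⇒P {z ∷ zs} (here (Pz , ¬Qz)) with Q? z | P? z
... | yes Qz | _      = contradiction Qz ¬Qz
... | no _   | no ¬Pz = contradiction Pz ¬Pz
... | no _   | yes _  = ℕ.s≤s (length-mono-≤ (filter⁺ Q? P? (λ { refl → Q⇒P }) (⊆-refl {x = zs})))
filter-length-< P? Q? Q⇒P {z ∷ zs} (there some) with Q? z | P? z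
... | yes Qz | no ¬Pz = contradiction (Q⇒P Qz) ¬Pz
... | yes _  | yes _  = ℕ.s≤s (filter-length-< P? Q? Q⇒P some)
... | no _   | yes _  = ℕₚ.m<n⇒m<1+n (filter-length-< P? Q? Q⇒P some)
... | no _   | no _   = filter-length-< P? Q? Q⇒P some

-- A finite type has decidable equality: compare positions in the enumeration.
finite⇒decEq : {C : Set} → Finite C → DecidableEquality C
finite⇒decEq {C} (enum , complete) x y =
  map′ position-injective (cong position) (position x Fin.≟ position y)
  where
  position : C → Fin (length enum)
  position z = Any.index (complete z)

  position-injective : position x ≡ position y → x ≡ y
  position-injective same = trans (lookup-index (complete x))
    (trans (cong (lookup enum) same) (sym (lookup-index (complete y))))

module FiniteRankedPoset {C : Set} {_≤_ : C → C → Set} (isPartialOrder : IsPartialOrder _≡_ _≤_)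
  (_≟_ : DecidableEquality C) (_≤?_ : Decidable _≤_) (finite : Finite C)
  (ρ : C → ℕ) (rank-cover : ∀ {x y} → _⋖_ _≤_ x y → ρ y ≡ suc (ρ x)) where

  open IsPartialOrder isPartialOrder using (antisym) renaming (refl to ≤-refl; trans to ≤-trans)

  _⊏_ _≺_ : C → C → Set
  _⊏_ = _<_ _≤_
  _≺_ = _⋖_ _≤_

  _⊏?_ : Decidable _⊏_
  x ⊏? y = (x ≤? y) ×-dec ¬? (x ≟ y)

  Interior : C → C → C → Set
  Interior x y z = x ⊏ z × z ⊏ y

  cover-if-no-interior : ∀ {x y} → x ⊏ y → (∀ z → ¬ Interior x y z) → x ≺ y
  cover-if-no-interior {x} {y} x⊏y empty = x⊏y , endpoint
    where
    endpoint : ∀ z → x ≤ z → z ≤ y → (z ≡ x) ⊎ (z ≡ y)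
    endpoint z x≤z z≤y with z ≟ x | z ≟ y
    ... | yes z≡x | _       = inj₁ z≡x
    ... | no _    | yes z≡y = inj₂ z≡y
    ... | no z≢x  | no z≢y  = ⊥-elim (empty z ((x≤z , z≢x ∘ sym) , (z≤y , z≢y)))

  intervalSize : C → C → ℕ
  intervalSize x y = length (filter (λ z → (x ≤? z) ×-dec (z ≤? y)) (proj₁ finite))

  subinterval-smaller : ∀ {x y x' y'} w → x ≤ x' → y' ≤ y → x ≤ w → w ≤ y →
                        ¬ (x' ≤ w × w ≤ y') → intervalSize x' y' ℕ.< intervalSize x y
  subinterval-smaller {x} {y} {x'} {y'} w x≤x' y'≤y x≤w w≤y w∉ =
    filter-length-< (λ z → (x ≤? z) ×-dec (z ≤? y)) (λ z → (x' ≤? z) ×-dec (z ≤? y'))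
      (λ (x'≤z , z≤y') → ≤-trans x≤x' x'≤z , ≤-trans z≤y' y'≤y)
      (Any.map (λ { refl → (x≤w , w≤y) , w∉ }) (proj₂ finite w))

  rank-mono-bounded : ∀ n {x y} → intervalSize x y ℕ.< n → x ⊏ y → ρ x ℕ.< ρ y
  rank-mono-bounded (suc n) {x} {y} size<n x⊏y@(x≤y , _)
    with Any.any? (λ z → (x ⊏? z) ×-dec (z ⊏? y)) (proj₁ finite)
  ... | yes some =
    let z , x⊏z@(x≤z , x≢z) , z⊏y@(z≤y , z≢y) = Any.satisfied some
        left  = subinterval-smaller y ≤-refl z≤y x≤y ≤-refl (λ (_ , y≤z) → z≢y (antisym z≤y y≤z))
        right = subinterval-smaller x x≤z ≤-refl ≤-refl x≤y (λ (z≤x , _) → x≢z (antisym x≤z z≤x))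
        bound = ℕ.s≤s⁻¹ size<n
    in ℕₚ.<-trans (rank-mono-bounded n (ℕₚ.<-≤-trans left bound) x⊏z)
                  (rank-mono-bounded n (ℕₚ.<-≤-trans right bound) z⊏y)
  ... | no none = ℕₚ.≤-reflexive (sym (rank-cover (cover-if-no-interior x⊏y interior-absent)))
    where
    interior-absent : ∀ z → ¬ Interior x y z
    interior-absent z between = none (Any.map (λ { refl → between }) (proj₂ finite z))

  rank-strictMono : ∀ {x y} → x ⊏ y → ρ x ℕ.< ρ y
  rank-strictMono = rank-mono-bounded _ ℕₚ.≤-refl

  cover-by-rank : ∀ {x y} → x ≤ y → ρ y ≡ suc (ρ x) → x ≺ y
  cover-by-rank {x} {y} x≤y ρy≡1+ρx = cover-if-no-interior (x≤y , x≢y) no-interior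
    where
    x≢y : x ≢ y
    x≢y refl = ℕₚ.1+n≢n (sym ρy≡1+ρx)

    no-interior : ∀ z → ¬ Interior x y z
    no-interior z (x⊏z , z⊏y) =
      ℕₚ.<⇒≱ (rank-strictMono x⊏z) (ℕ.s≤s⁻¹ (subst (ρ z ℕ.<_) ρy≡1+ρx (rank-strictMono z⊏y)))

module FiniteModularLattice {C : Set} {_≤_ : C → C → Set} {_∨_ _∧_ : C → C → C}
  (isLattice : IsLattice _≡_ _≤_ _∨_ _∧_) (finite : Finite C)
  (ρ : C → ℕ) (rank-cover : ∀ {x y} → _⋖_ _≤_ x y → ρ y ≡ suc (ρ x))
  (rank-modular : ∀ s t → ρ (s ∨ t) ℕ.+ ρ (s ∧ t) ≡ ρ s ℕ.+ ρ t) where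

  open IsLattice isLattice
    using (isPartialOrder; isJoinSemilattice; x≤x∨y; y≤x∨y; x∧y≤x; x∧y≤y; ∧-greatest)

  -- finiteness decides equality, and in a lattice x ≤ y iff x ∨ y = y
  _≟_ : DecidableEquality C
  _≟_ = finite⇒decEq finite

  _≤?_ : Decidable _≤_
  _≤?_ = JoinSemilatticeProperties.≈-dec⇒≤-dec
    (record { isJoinSemilattice = isJoinSemilattice }) _≟_

  open FiniteRankedPoset isPartialOrder _≟_ _≤?_ finite ρ rank-cover public
    using (_≺_; cover-by-rank)

  meet-of-covers : ∀ {a b b'} → a ≺ b → a ≺ b' → b ≢ b' → b ∧ b' ≡ a
  meet-of-covers {a} {b} {b'} ((a≤b , a≢b) , a⋖b) ((a≤b' , _) , a⋖b') b≢b'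
    with a⋖b (b ∧ b') (∧-greatest a≤b a≤b') (x∧y≤x b b')
  ... | inj₁ meet≡a = meet≡a
  ... | inj₂ meet≡b with a⋖b' b a≤b (subst (_≤ b') meet≡b (x∧y≤y b b'))
  ...   | inj₁ b≡a  = contradiction (sym b≡a) a≢b
  ...   | inj₂ b≡b' = contradiction b≡b' b≢b'

  join-of-covers : ∀ {a b b'} → a ≺ b → a ≺ b' → b ≢ b' → b ≺ (b ∨ b') × b' ≺ (b ∨ b')
  join-of-covers {a} {b} {b'} a≺b a≺b' b≢b' =
    cover-by-rank (x≤x∨y b b') (trans rank-join (cong suc (sym (rank-cover a≺b)))) ,
    cover-by-rank (y≤x∨y b b') (trans rank-join (cong suc (sym (rank-cover a≺b'))))
    where
    open ≡-Reasoning
    rank-join : ρ (b ∨ b') ≡ suc (suc (ρ a))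
    rank-join = ℕₚ.+-cancelʳ-≡ (ρ a) _ _ (begin
      ρ (b ∨ b') ℕ.+ ρ a          ≡⟨ cong (λ m → ρ (b ∨ b') ℕ.+ ρ m) (sym (meet-of-covers a≺b a≺b' b≢b')) ⟩
      ρ (b ∨ b') ℕ.+ ρ (b ∧ b')   ≡⟨ rank-modular b b' ⟩
      ρ b ℕ.+ ρ b'                ≡⟨ cong₂ ℕ._+_ (rank-cover a≺b) (rank-cover a≺b') ⟩
      suc (ρ a) ℕ.+ suc (ρ a)     ≡⟨ cong suc (ℕₚ.+-suc (ρ a) (ρ a)) ⟩
      suc (suc (ρ a)) ℕ.+ ρ a     ∎)

module DiamondColouredChains {C I : Set} {_≤_ : C → C → Set} {_∨_ _∧_ : C → C → C}
  (isLattice : IsLattice _≡_ _≤_ _∨_ _∧_) (finite : Finite C)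
  (ρ : C → ℕ) (rank-cover : ∀ {x y} → _⋖_ _≤_ x y → ρ y ≡ suc (ρ x))
  (rank-modular : ∀ s t → ρ (s ∨ t) ℕ.+ ρ (s ∧ t) ≡ ρ s ℕ.+ ρ t)
  (col : EdgeColoring _≤_ I) (col-wd : ColoringWellDefined _≤_ col)
  (diamond : DiamondColored _≤_ col) where

  open IsLattice isLattice using (antisym; ∨-least; x≤x∨y) renaming (refl to ≤-refl; trans to ≤-trans)
  open FiniteModularLattice isLattice finite ρ rank-cover rank-modular

  colour : ∀ {x y} → x ≺ y → I
  colour = col _ _

  cover-not-below : ∀ {a b} → a ≺ b → ¬ b ≤ a
  cover-not-below ((a≤b , a≢b) , _) b≤a = a≢b (antisym a≤b b≤a)

  diamond-completion : ∀ {a b b'} (E : a ≺ b) (F : a ≺ b') → b ≢ b' →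
    Σ (b ≺ (b ∨ b')) λ E' → Σ (b' ≺ (b ∨ b')) λ F' → colour E' ≡ colour F × colour F' ≡ colour E
  diamond-completion {a} {b} {b'} E F b≢b' =
    let E' , F' = join-of-covers E F b≢b'
    in E' , F' , diamond a b b' (b ∨ b') E E' F F' b≢b'

  data Chain : C → C → Set where
    []  : ∀ {x} → Chain x x
    _∷_ : ∀ {x y z} → x ≺ y → Chain y z → Chain x z

  colours : ∀ {x z} → Chain x z → List I
  colours []      = []
  colours (E ∷ R) = colour E ∷ colours R

  chain-≤ : ∀ {x z} → Chain x z → x ≤ z
  chain-≤ []      = ≤-refl
  chain-≤ (E ∷ R) = ≤-trans (proj₁ (proj₁ E)) (chain-≤ R)

  exchange : ∀ {a b t} (E : a ≺ b) (R : Chain a t) → b ≤ t →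
             Σ (Chain b t) λ R' → colour E ∷ colours R' ↭ colours R
  exchange E [] b≤a = contradiction b≤a (cover-not-below E)
  exchange {b = b} E (_∷_ {y = b'} F R) b≤t with b ≟ b'
  ... | yes refl = R , ↭-reflexive (cong (_∷ colours R) (col-wd _ _ E F))
  ... | no b≢b' =
    let E' , F' , E'-colour , F'-colour = diamond-completion E F b≢b'
        R' , shuffle = exchange F' R (∨-least b≤t (chain-≤ R))
    in E' ∷ R' , (begin
      colour E ∷ colour E' ∷ colours R'  ≡⟨ cong (λ c → colour E ∷ c ∷ colours R') E'-colour ⟩
      colour E ∷ colour F ∷ colours R'   ↭⟨ ↭-swap _ _ ↭-refl ⟩
      colour F ∷ colour E ∷ colours R'   ≡⟨ cong (λ c → colour F ∷ c ∷ colours R') (sym F'-colour) ⟩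
      colour F ∷ colour F' ∷ colours R'  ↭⟨ ↭-prep _ shuffle ⟩
      colour F ∷ colours R               ∎)
    where open PermutationReasoning

  colours-↭ : ∀ {x t} (R S : Chain x t) → colours R ↭ colours S
  colours-↭ [] []      = ↭-refl
  colours-↭ [] (F ∷ S) = contradiction (chain-≤ S) (cover-not-below F)
  colours-↭ (E ∷ R) S  =
    let S' , shuffle = exchange E S (chain-≤ R)
    in ↭-trans (↭-prep _ (colours-↭ R S')) shuffle

  first-last : ∀ {a b u t} (E : a ≺ b) (R : Chain a u) (G : u ≺ t) → b ≤ t → ¬ b ≤ u →
               colour E ≡ colour G
  first-last E [] G@(_ , a⋖t) b≤t _ with a⋖t _ (proj₁ (proj₁ E)) b≤t
  ... | inj₁ b≡a  = contradiction (sym b≡a) (proj₂ (proj₁ E))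
  ... | inj₂ refl = col-wd _ _ E G
  first-last {b = b} E (_∷_ {y = b'} F R) G b≤t b≰u with b ≟ b'
  ... | yes refl = contradiction (chain-≤ R) b≰u
  ... | no b≢b' =
    let E' , F' , _ , F'-colour = diamond-completion E F b≢b'
        b'≤t = ≤-trans (chain-≤ R) (proj₁ (proj₁ G))
    in trans (sym F'-colour)
             (first-last F' R G (∨-least b≤t b'≤t) (λ join≤u → b≰u (≤-trans (x≤x∨y b b') join≤u)))

  relocate : ∀ {x x' t t'} → x ≡ x' → t ≡ t' → Chain x t → Chain x' t'
  relocate refl refl R = R

  colours-relocate : ∀ {x x' t t'} (x≡x' : x ≡ x') (t≡t' : t ≡ t') (R : Chain x t) →
                     colours (relocate x≡x' t≡t' R) ≡ colours R
  colours-relocate refl refl R = refl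

  vertexChain : ∀ p (v : Fin (suc p) → C) → (∀ k → v (inject₁ k) ≺ v (suc k)) →
                Chain (v zero) (v (fromℕ p))
  vertexChain zero    v step = []
  vertexChain (suc p) v step = step zero ∷ vertexChain p (v ∘ suc) (step ∘ suc)

  colours-vertexChain : ∀ p (v : Fin (suc p) → C) (step : ∀ k → v (inject₁ k) ≺ v (suc k)) →
                        colours (vertexChain p v step) ≡ tabulate (colour ∘ step)
  colours-vertexChain zero    v step = refl
  colours-vertexChain (suc p) v step = cong (colour (step zero) ∷_) (colours-vertexChain p _ _)

  path-colours-↭ : ∀ {s t p q} (P : Path _≤_ s t p) (Q : Path _≤_ s t q) →
                   tabulate (stepColor _≤_ col P) ↭ tabulate (stepColor _≤_ col Q)
  path-colours-↭ {p = p} {q} P Q = begin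
    tabulate (stepColor _≤_ col P)   ≡⟨ sym (colours-vertexChain p (vert P) (step P)) ⟩
    colours chainP                   ↭⟨ colours-↭ chainP chainQ′ ⟩
    colours chainQ′                  ≡⟨ colours-relocate same-start same-end chainQ ⟩
    colours chainQ                   ≡⟨ colours-vertexChain q (vert Q) (step Q) ⟩
    tabulate (stepColor _≤_ col Q)   ∎
    where
    open PermutationReasoning using (begin_; _∎; step-≡-⟩; step-↭-⟩)
    chainP : Chain (vert P zero) (vert P (fromℕ p))
    chainP = vertexChain p (vert P) (step P)
    chainQ : Chain (vert Q zero) (vert Q (fromℕ q))
    chainQ = vertexChain q (vert Q) (step Q)
    same-start : vert Q zero ≡ vert P zero
    same-start = trans (start Q) (sym (start P))
    same-end : vert Q (fromℕ q) ≡ vert P (fromℕ p)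
    same-end = trans (end Q) (sym (end P))
    chainQ′ : Chain (vert P zero) (vert P (fromℕ p))
    chainQ′ = relocate same-start same-end chainQ

  path-first-last : ∀ {s t} p q (P : Path _≤_ s t p) (Q : Path _≤_ s t q) →
                    FirstLastClause _≤_ col P Q
  path-first-last zero    _       _ _ = tt
  path-first-last (suc p) zero    _ _ = tt
  path-first-last (suc p) (suc q) P Q (r₁≰r′ , _) =
    first-last (step P zero) (relocate same-start refl initQ) (step Q (fromℕ q)) r₁≤t r₁≰r′
    where
    same-start : vert Q zero ≡ vert P zero
    same-start = trans (start Q) (sym (start P))
    -- Q without its last covering
    initQ : Chain (vert Q zero) (vert Q (inject₁ (fromℕ q)))
    initQ = vertexChain q (vert Q ∘ inject₁) (step Q ∘ inject₁)
    r₁≤t : vert P (suc zero) ≤ vert Q (fromℕ (suc q))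
    r₁≤t = subst (_ ≤_) (trans (end P) (sym (end Q)))
                 (chain-≤ (vertexChain p (vert P ∘ suc) (step P ∘ suc)))

proposition3 : {C I : Set} (_≤_ : C → C → Set) (_∨_ _∧_ : C → C → C) →
    IsLattice _≡_ _≤_ _∨_ _∧_ → Finite C → IsModularRanked _≤_ _∨_ _∧_ →
    (col : EdgeColoring _≤_ I) → ColoringWellDefined _≤_ col → DiamondColored _≤_ col →
    (s t : C) → s ≤ t → (p q : ℕ) (P : Path _≤_ s t p) (Q : Path _≤_ s t q) →
    (p ≡ q)
    × (∀ (i : I) → (Σ (Fin p) λ k → stepColor _≤_ col P k ≡ i) ↔ (Σ (Fin q) λ k → stepColor _≤_ col Q k ≡ i))
    × FirstLastClause _≤_ col P Q
proposition3 _≤_ _∨_ _∧_ isLattice finite (ρ , _ , _ , _ , rank-cover , rank-modular)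
             col col-wd diamond s t _ p q P Q =
  same-length , same-multiplicities , path-first-last p q P Q
  where
  open DiamondColouredChains isLattice finite ρ (rank-cover _ _) rank-modular col col-wd diamond
  open ≡-Reasoning

  shuffle : tabulate (stepColor _≤_ col P) ↭ tabulate (stepColor _≤_ col Q)
  shuffle = path-colours-↭ P Q

  same-length : p ≡ q
  same-length = begin
    p                                         ≡⟨ sym (length-tabulate _) ⟩
    length (tabulate (stepColor _≤_ col P))   ≡⟨ ↭-length shuffle ⟩
    length (tabulate (stepColor _≤_ col Q))   ≡⟨ length-tabulate _ ⟩
    q                                         ∎

  same-multiplicities : ∀ i → (Σ (Fin p) λ k → stepColor _≤_ col P k ≡ i) ↔
                              (Σ (Fin q) λ k → stepColor _≤_ col Q k ≡ i)
  same-multiplicities i =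
    ↔-trans (occurrences↔∈ _ i) (↔-trans (↭⇒∼bag shuffle) (↔-sym (occurrences↔∈ _ i)))
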